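{- Let $q$ be a prime power, $1\le\ell\le m-1$, $V_m$ an $m$-dimensional $\mathbb{F}_q$-vector space with ordered basis $\mathcal{B}=\{v_1,\dots,v_m\}$, and $\alpha\in I(\ell,m)$ with $\alpha_\ell=m$ and $\alpha_1,\dots,\alpha_\ell$ not consecutive integers; let $k$, $\alpha'$, $\mathfrak{S}_\alpha(\ell,V_m,\mathcal{B})$ be as defined below. Let $\Pi_\alpha$ be a hyperplane of $\mathbb{P}^{k_\alpha-1}$ and $M_\alpha=\max\{|\Pi_\alpha\cap\Omega|:\Omega\in\mathfrak{S}_\alpha(\ell,V_m,\mathcal{B})\}$. Then $$|\Pi_\alpha\cap\Omega_\alpha(\ell,V_m,\mathcal{B})|\le\left(\frac{q^{m-\alpha_k}-1}{q^{(m-\alpha_k)-(\ell-k)}-1}\right)M_\alpha.$$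
   Context: $V_i=\mathrm{span}\{v_1,\dots,v_i\}$. $I(\ell,n)$ is the set of integer tuples $1\le\gamma_1<\dots<\gamma_\ell\le n$ with componentwise order; $\nabla(\alpha)=\{\beta\in I(\ell,m):\beta\le\alpha\}$, $k_\alpha=|\nabla(\alpha)|$. $\Omega_\alpha(\ell,V_m,\mathcal{B})=\{L\subseteq V_m:\dim L=\ell,\ \dim(L\cap V_{\alpha_j})\ge j\ \forall j\}$. Plücker embedding: $L$ maps to the point of $\mathbb{P}(\bigwedge^\ell V_m)$ with coordinates $X_\beta(L)$, $\beta\in I(\ell,m)$, the $\ell\times\ell$ minor on columns $\beta$ of a matrix whose rows are coordinates w.r.t. $\mathcal{B}$ of a basis of $L$; $\mathbb{P}^{k_\alpha-1}$ is the linear subspace $\{X_\beta=0\ \forall\beta\notin\nabla(\alpha)\}$, containing the image of $\Omega_\alpha(\ell,V_m,\mathcal{B})$; a hyperplane of it is the zero set of a nonzero linear form $\sum_{\beta\in\nabla(\alpha)}c_\beta X_\beta$, and $\Pi_\alpha\cap S$ is the set of $L\in S$ whose Plücker point lies on $\Pi_\alpha$. $k=\max\{j:\alpha_{j+1}-\alpha_j\ge2\}$; $\alpha'\in I(\ell,m-1)$ with $\alpha'_i=\alpha_i$ for $i\le k$, $\alpha'_i=\alpha_i-1$ for $i>k$. For an $(m-1)$-dimensional subspace $W_{m-1}\subseteq V_m$ with ordered basis $\mathcal{B}_1=\{w_1,\dots,w_{m-1}\}$, $W_i=\mathrm{span}\{w_1,\dots,w_i\}$, $\Omega_{\alpha'}(\ell,W_{m-1},\mathcal{B}_1)=\{L\subseteq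 W_{m-1}:\dim L=\ell,\ \dim(L\cap W_{\alpha'_j})\ge j\ \forall j\}$; $\mathfrak{S}_\alpha(\ell,V_m,\mathcal{B})$ is the set of all such $\Omega_{\alpha'}(\ell,W_{m-1},\mathcal{B}_1)$ with $W_{\alpha_i}=V_{\alpha_i}$ for $i=1,\dots,k$ and $V_{\alpha_k}\subseteq W_{m-1}\subseteq V_m$ (each such set is contained in $\Omega_\alpha(\ell,V_m,\mathcal{B})$). -}

module Defs where

open import Level using (0ℓ)
open import Algebra.Bundles using (CommutativeRing)
open import Data.Nat using (ℕ; zero; suc; _∸_; _^_; _≤_; _<_; _≤ᵇ_; _<ᵇ_) renaming (_+_ to _+ℕ_)
open import Data.Nat.Primality using (Prime)
open import Data.Fin using (Fin; toℕ; punchIn) renaming (zero to fz; suc to fs)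
open import Data.Vec.Functional using (_∷_)
open import Data.Bool using (Bool; true; false; _∧_; if_then_else_)
open import Data.List using (List; length)
open import Data.List.Relation.Unary.All using (All)
open import Data.List.Relation.Unary.Any using (Any)
open import Data.List.Relation.Unary.AllPairs using (AllPairs)
open import Data.Product using (Σ; ∃; _×_; _,_)
open import Relation.Binary.PropositionalEquality using (_≡_)
open import Relation.Nullary using (¬_)
open import Data.Unit using (⊤)

HasCard : {A : Set} → (A → A → Set) → (A → Set) → ℕ → Set
HasCard {A} _~_ P n =
  Σ (List A) λ xs →
    (length xs ≡ n) × All P xs × AllPairs (λ x y → ¬ (x ~ y)) xs
    × (∀ x → P x → Any (x ~_) xs)

IsPrimePower : ℕ → Set
IsPrimePower q = Σ ℕ λ p → Σ ℕ λ e → Prime p × (1 ≤ e) × (q ≡ p ^ e)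

record IsFiniteField (R : CommutativeRing 0ℓ 0ℓ) (q : ℕ) : Set where
  open CommutativeRing R
  field
    0≉1   : ¬ (0# ≈ 1#)
    inv   : ∀ x → ¬ (x ≈ 0#) → Σ Carrier λ y → (x * y) ≈ 1#
    card  : HasCard _≈_ (λ _ → ⊤) q

module LinAlg (R : CommutativeRing 0ℓ 0ℓ) where
  open CommutativeRing R

  sumFin : (n : ℕ) → (Fin n → Carrier) → Carrier
  sumFin zero    f = 0#
  sumFin (suc n) f = f fz + sumFin n (λ i → f (fs i))

  -- vectors of V_m, in coordinates w.r.t. B = (v_1,…,v_m)
  Vect : ℕ → Set
  Vect m = Fin m → Carrier

  _≈v_ : {m : ℕ} → Vect m → Vect m → Set
  u ≈v w = ∀ x → u x ≈ w x

  -- the standard basis vector v_{i+1}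
  e : {m : ℕ} → Fin m → Vect m
  e i x with toℕ i Data.Nat.≟ toℕ x
  ... | Relation.Nullary.yes _ = 1#
  ... | Relation.Nullary.no _  = 0#

  LinIndep : {m r : ℕ} → (Fin r → Vect m) → Set
  LinIndep {m} {r} u =
    ∀ (c : Fin r → Carrier) → (∀ x → sumFin r (λ i → c i * u i x) ≈ 0#)
      → ∀ i → c i ≈ 0#

  InSpanPrefix : {m r : ℕ} → (Fin r → Vect m) → ℕ → Vect m → Set
  InSpanPrefix {m} {r} u a v =
    Σ (Fin r → Carrier) λ c → (∀ i → a ≤ toℕ i → c i ≈ 0#)
      × (v ≈v (λ x → sumFin r (λ i → c i * u i x)))

  InSpan : {m r : ℕ} → (Fin r → Vect m) → Vect m → Set
  InSpan {m} {r} u = InSpanPrefix u r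

  InV : {m : ℕ} → ℕ → Vect m → Set
  InV {m} a = InSpanPrefix {m} {m} e a

  -- An ℓ-dimensional subspace L of V_m is represented by an ordered basis
  -- (an ℓ × m matrix of full rank); two such represent the same L iff
  -- they have the same span.
  Basis : ℕ → ℕ → Set
  Basis l m = Fin l → Vect m

  SameSpan : {l m : ℕ} → Basis l m → Basis l m → Set
  SameSpan b b' = (∀ i → InSpan b' (b i)) × (∀ i → InSpan b (b' i))

  DimMeetGe : {l m : ℕ} → Basis l m → (Vect m → Set) → ℕ → Set
  DimMeetGe {l} {m} b U j =
    Σ (Fin j → Vect m) λ u → LinIndep u × (∀ i → InSpan b (u i) × U (u i))

  det : (n : ℕ) → (Fin n → Fin n → Carrier) → Carrier
  det zero    A = 1#
  det (suc n) A =
    sumFin (suc n) λ j →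
      sgn (toℕ j) * (A fz j * det n (λ r c → A (fs r) (punchIn j c)))
    where
    sgn : ℕ → Carrier
    sgn zero          = 1#
    sgn (suc zero)    = - 1#
    sgn (suc (suc k)) = sgn k

  X : {l m : ℕ} → (Fin l → Fin m) → Basis l m → Carrier
  X {l} β b = det l (λ r c → b r (β c))

  sumTuples : (l m : ℕ) → ((Fin l → Fin m) → Carrier) → Carrier
  sumTuples zero    m f = f (λ ())
  sumTuples (suc l) m f = sumFin m (λ x → sumTuples l m (λ g → f (x ∷ g)))

-- Index combinatorics.  α is given as a function ℕ → ℕ of which only
-- α 1, …, α ℓ are relevant (1-based, as in the paper).

allB : (n : ℕ) → (Fin n → Bool) → Bool
allB zero    f = true
allB (suc n) f = f fz ∧ allB n (λ i → f (fs i))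

InI : ℕ → ℕ → (ℕ → ℕ) → Set
InI l m α = (1 ≤ α 1) × (α l ≤ m)
  × (∀ i → 1 ≤ i → i < l → α i < α (suc i))

-- β ∈ ∇(α), for β : Fin ℓ → Fin m (column indices, 0-based, so
-- β_{i+1} = toℕ (β i) + 1): β strictly increasing and β ≤ α componentwise
inNablaB : (l m : ℕ) → (ℕ → ℕ) → (Fin l → Fin m) → Bool
inNablaB l m α β =
  allB l (λ i → suc (toℕ (β i)) ≤ᵇ α (suc (toℕ i)))
  ∧ allB l (λ i → allB l (λ j →
      if toℕ i <ᵇ toℕ j then toℕ (β i) <ᵇ toℕ (β j) else true))

NotConsecutive : ℕ → (ℕ → ℕ) → Set
NotConsecutive l α = Σ ℕ λ j → (1 ≤ j) × (j < l) × (2 +ℕ α j ≤ α (suc j))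

IsK : ℕ → (ℕ → ℕ) → ℕ → Set
IsK l α k = (1 ≤ k) × (k < l) × (2 +ℕ α k ≤ α (suc k))
  × (∀ j → k < j → j < l → α (suc j) < 2 +ℕ α j)

alpha' : ℕ → (ℕ → ℕ) → ℕ → ℕ
alpha' k α i = if i ≤ᵇ k then α i else α i ∸ 1

module Schubert (R : CommutativeRing 0ℓ 0ℓ) (l m : ℕ) (α : ℕ → ℕ) where
  open CommutativeRing R
  open LinAlg R

  OmegaAlpha : Basis l m → Set
  OmegaAlpha b = LinIndep b
    × (∀ j → 1 ≤ j → j ≤ l → DimMeetGe b (InV (α j)) j)

  -- a hyperplane Π_α of P^{k_α − 1}: Σ_{β ∈ ∇(α)} c_β X_β = 0, with the
  -- coefficients (c_β)_{β ∈ ∇(α)} not all zero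
  IsHyperplane : ((Fin l → Fin m) → Carrier) → Set
  IsHyperplane c = Σ (Fin l → Fin m) λ β → (inNablaB l m α β ≡ true) × ¬ (c β ≈ 0#)

  OnPi : ((Fin l → Fin m) → Carrier) → Basis l m → Set
  OnPi c b = sumTuples l m (λ β → if inNablaB l m α β then c β * X β b else 0#) ≈ 0#

  -- (W_{m−1}, B_1 = (w_1,…,w_{m−1})) gives a member of 𝔖_α(ℓ, V_m, B)
  Admissible : ℕ → (Fin (m ∸ 1) → Vect m) → Set
  Admissible k w = LinIndep w
    × (∀ i → 1 ≤ i → i ≤ k → ∀ v →
         (InSpanPrefix w (α i) v → InV (α i) v) × (InV (α i) v → InSpanPrefix w (α i) v))
    × (∀ v → InV (α k) v → InSpan w v)

  OmegaPrime : ℕ → (Fin (m ∸ 1) → Vect m) → Basis l m → Set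
  OmegaPrime k w b = LinIndep b × (∀ i → InSpan w (b i))
    × (∀ j → 1 ≤ j → j ≤ l → DimMeetGe b (InSpanPrefix w (alpha' k α j)) j)

  IsMaxS : ℕ → ((Fin l → Fin m) → Carrier) → ℕ → Set
  IsMaxS k c M =
    (∀ w → Admissible k w → ∀ n →
       HasCard SameSpan (λ b → OmegaPrime k w b × OnPi c b) n → n ≤ M)
    × Σ (Fin (m ∸ 1) → Vect m) λ w → Admissible k w
        × HasCard SameSpan (λ b → OmegaPrime k w b × OnPi c b) M

{-# OPTIONS --safe #-}
-- Double counting of pairs (L, φ) with L ∈ Ω_α ∩ Π_α and φ a linear functional on V_m
-- vanishing on V_{α_k} + L.  Write n = α_k and a = m − n.
--
-- Since dim (L ∩ V_n) ≥ k, the last a coordinates of a basis of L span a space of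
-- dimension at most ℓ − k, so every L is counted at least q^(a − (ℓ − k)) times.
--
-- The zero functional is counted N times.  A nonzero φ has kernel a hyperplane
-- W ⊇ V_n, and pivoting on a nonzero coordinate of φ beyond n gives a basis of W
-- whose first n vectors are v_1, …, v_n, so W belongs to 𝔖_α.  For j > k the
-- indices are consecutive, α_j = m − (ℓ − j), so the j-th conditions of Ω_α and of
-- Ω_α'(W) hold automatically; hence the L ∈ Ω_α inside W are exactly Ω_α'(W), and
-- each of the q^a − 1 nonzero φ is counted at most M_α times.  Altogether
-- N q^(a − (ℓ − k)) ≤ N + (q^a − 1) M_α.
module Submission where

open import Defs
open import Level using (0ℓ)
open import Algebra.Bundles using (CommutativeRing; AbelianGroup)
open import Data.Nat as ℕ using (ℕ; zero; suc; _∸_; _^_; _≤_; _<_; z≤n; s≤s)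
import Data.Nat.Properties as ℕₚ
import Data.Nat.ListAction as ListAction
open import Data.Fin as Fin using (Fin; toℕ; punchIn; punchOut) renaming (zero to fz; suc to fs)
import Data.Fin.Properties as Finₚ
open import Data.Bool as Bool using (true; false)
open import Data.Empty using (⊥-elim)
open import Data.Product using (_×_; Σ; ∃; _,_; proj₁; proj₂)
open import Data.Sum using (_⊎_; inj₁; inj₂; [_,_]′)
open import Data.Unit using (⊤; tt)
open import Data.Vec.Functional using () renaming (_∷_ to _∷ᵥ_)
import Data.List as List
import Data.List.Properties as Listₚ
open import Data.List.Membership.Propositional.Properties using (∈-lookup)
import Data.List.Relation.Unary.All as All
import Data.List.Relation.Unary.All.Properties as Allₚ
import Data.List.Relation.Unary.Any as Any
import Data.List.Relation.Unary.Any.Properties as Anyₚ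
open import Data.List.Relation.Unary.AllPairs using (AllPairs; _∷_)
import Data.List.Relation.Unary.AllPairs.Properties as AllPairsₚ
open import Function using (_∘_; case_of_)
open import Relation.Binary.Bundles using (Setoid)
open import Relation.Binary.Definitions using (Decidable)
open import Relation.Binary.PropositionalEquality as ≡ using (_≡_; _≢_)
import Relation.Binary.Reasoning.Setoid
open import Relation.Nullary using (¬_; Dec; yes; no; ¬?)
open import Relation.Nullary.Decidable using (decidable-stable)
open import Relation.Unary using () renaming (Decidable to Decidable₁)

module _ {d p : ℕ} (d≤p : d ≤ p) where

  shiftBy : Fin (p ∸ d) → Fin p
  shiftBy t =
    Fin.fromℕ< (≡.subst (d ℕ.+ toℕ t <_) (ℕₚ.m+[n∸m]≡n d≤p) (ℕₚ.+-monoʳ-< d (Finₚ.toℕ<n t)))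

  toℕ-shiftBy : ∀ t → toℕ (shiftBy t) ≡ d ℕ.+ toℕ t
  toℕ-shiftBy t = Finₚ.toℕ-fromℕ< _

  shiftBy-injective : ∀ {t t'} → toℕ (shiftBy t) ≡ toℕ (shiftBy t') → t ≡ t'
  shiftBy-injective {t} {t'} eq = Finₚ.toℕ-injective (ℕₚ.+-cancelˡ-≡ d _ _
    (≡.trans (≡.sym (toℕ-shiftBy t)) (≡.trans eq (toℕ-shiftBy t'))))

  shiftBy-surjective : ∀ i → d ≤ toℕ i → ∃ λ t → shiftBy t ≡ i
  shiftBy-surjective i d≤i = t , Finₚ.toℕ-injective (begin
      toℕ (shiftBy t)    ≡⟨ toℕ-shiftBy t ⟩
      d ℕ.+ toℕ t        ≡⟨ ≡.cong (d ℕ.+_) (Finₚ.toℕ-fromℕ< _) ⟩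
      d ℕ.+ (toℕ i ∸ d)  ≡⟨ ℕₚ.m+[n∸m]≡n d≤i ⟩
      toℕ i              ∎)
    where
    open ≡.≡-Reasoning
    t = Fin.fromℕ< (ℕₚ.∸-monoˡ-< (Finₚ.toℕ<n i) d≤i)

toℕ≤toℕ-punchIn : ∀ {n} (i : Fin (suc n)) j → toℕ j ≤ toℕ (punchIn i j)
toℕ≤toℕ-punchIn fz     j      = ℕₚ.n≤1+n (toℕ j)
toℕ≤toℕ-punchIn (fs i) fz     = z≤n
toℕ≤toℕ-punchIn (fs i) (fs j) = s≤s (toℕ≤toℕ-punchIn i j)

toℕ-punchIn-< : ∀ {n} (i : Fin (suc n)) j → toℕ j < toℕ i → toℕ (punchIn i j) ≡ toℕ j
toℕ-punchIn-< (fs i) fz     _         = ≡.refl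
toℕ-punchIn-< (fs i) (fs j) (s≤s j<i) = ≡.cong suc (toℕ-punchIn-< i j j<i)

punchIn-elim : ∀ {n} {P : Fin (suc n) → Set} p → P p → (∀ i → P (punchIn p i)) → ∀ x → P x
punchIn-elim {P = P} p Pp P-punchIn x with p Finₚ.≟ x
... | yes ≡.refl = Pp
... | no  p≢x    = ≡.subst P (Finₚ.punchIn-punchOut p≢x) (P-punchIn (punchOut p≢x))

module RingLinearAlgebra (R : CommutativeRing 0ℓ 0ℓ) where
  open CommutativeRing R
  open LinAlg R
  open import Algebra.Properties.Semiring.Sum semiring
    using (sum; sum-cong-≋; sum-replicate-zero; sum-remove; ∑-distrib-+; ∑-comm;
           *-distribˡ-sum; *-distribʳ-sum)
  open import Algebra.Properties.Ring ring using (-1*x≈-x; [y-z]x≈yx-zx)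
  open import Algebra.Properties.Group (AbelianGroup.group +-abelianGroup)
    using (x∙y⁻¹≈ε⇒x≈y; x≈y⇒x∙y⁻¹≈ε)
  open import Algebra.Properties.CommutativeSemigroup *-commutativeSemigroup using (x∙yz≈y∙xz)
  open import Relation.Binary.Reasoning.Setoid setoid

  sumFin≈sum : ∀ n (f : Fin n → Carrier) → sumFin n f ≈ sum f
  sumFin≈sum n f = reflexive (sumFin≡sum n f)
    where
    sumFin≡sum : ∀ n (f : Fin n → Carrier) → sumFin n f ≡ sum f
    sumFin≡sum zero    f = ≡.refl
    sumFin≡sum (suc n) f = ≡.cong (f fz +_) (sumFin≡sum n (f ∘ fs))

  sumFin-cong : ∀ n {f g : Fin n → Carrier} → (∀ i → f i ≈ g i) → sumFin n f ≈ sumFin n g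
  sumFin-cong n {f} {g} f≈g = begin
    sumFin n f ≈⟨ sumFin≈sum _ f ⟩
    sum f      ≈⟨ sum-cong-≋ f≈g ⟩
    sum g      ≈⟨ sumFin≈sum _ g ⟨
    sumFin n g ∎

  sumFin-zero : ∀ n {f : Fin n → Carrier} → (∀ i → f i ≈ 0#) → sumFin n f ≈ 0#
  sumFin-zero n {f} f≈0 = begin
    sumFin n f         ≈⟨ sumFin≈sum _ f ⟩
    sum f              ≈⟨ sum-cong-≋ {n} f≈0 ⟩
    sum {n} (λ _ → 0#) ≈⟨ sum-replicate-zero n ⟩
    0#                 ∎

  sumFin-+ : ∀ n (f g : Fin n → Carrier) → sumFin n (λ i → f i + g i) ≈ sumFin n f + sumFin n g
  sumFin-+ n f g = begin
    sumFin n (λ i → f i + g i) ≈⟨ sumFin≈sum n _ ⟩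
    sum (λ i → f i + g i)      ≈⟨ ∑-distrib-+ f g ⟩
    sum f + sum g              ≈⟨ +-cong (sumFin≈sum _ f) (sumFin≈sum _ g) ⟨
    sumFin n f + sumFin n g    ∎

  *-distribˡ-sumFin : ∀ n c (f : Fin n → Carrier) → c * sumFin n f ≈ sumFin n (λ i → c * f i)
  *-distribˡ-sumFin n c f = begin
    c * sumFin n f           ≈⟨ *-congˡ (sumFin≈sum _ f) ⟩
    c * sum f                ≈⟨ *-distribˡ-sum c f ⟩
    sum (λ i → c * f i)      ≈⟨ sumFin≈sum n _ ⟨
    sumFin n (λ i → c * f i) ∎

  *-distribʳ-sumFin : ∀ n c (f : Fin n → Carrier) → sumFin n f * c ≈ sumFin n (λ i → f i * c)
  *-distribʳ-sumFin n c f = begin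
    sumFin n f * c           ≈⟨ *-congʳ (sumFin≈sum _ f) ⟩
    sum f * c                ≈⟨ *-distribʳ-sum c f ⟩
    sum (λ i → f i * c)      ≈⟨ sumFin≈sum n _ ⟨
    sumFin n (λ i → f i * c) ∎

  sumFin-neg : ∀ n (f : Fin n → Carrier) → sumFin n (λ i → - f i) ≈ - sumFin n f
  sumFin-neg n f = begin
    sumFin n (λ i → - f i)      ≈⟨ sumFin-cong n (λ i → -1*x≈-x (f i)) ⟨
    sumFin n (λ i → - 1# * f i) ≈⟨ *-distribˡ-sumFin n (- 1#) f ⟨
    - 1# * sumFin n f           ≈⟨ -1*x≈-x _ ⟩
    - sumFin n f                ∎

  sumFin-comm : ∀ m n (f : Fin m → Fin n → Carrier) →
    sumFin m (λ i → sumFin n (f i)) ≈ sumFin n (λ j → sumFin m (λ i → f i j))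
  sumFin-comm m n f = begin
    sumFin m (λ i → sumFin n (f i))         ≈⟨ sumFin-cong m (λ i → sumFin≈sum n (f i)) ⟩
    sumFin m (λ i → sum (f i))              ≈⟨ sumFin≈sum m _ ⟩
    sum (λ i → sum (f i))                   ≈⟨ ∑-comm f ⟩
    sum (λ j → sum (λ i → f i j))           ≈⟨ sumFin≈sum n _ ⟨
    sumFin n (λ j → sum (λ i → f i j))      ≈⟨ sumFin-cong n (λ j → sumFin≈sum m _) ⟨
    sumFin n (λ j → sumFin m (λ i → f i j)) ∎

  sumFin-remove : ∀ n (i : Fin (suc n)) (f : Fin (suc n) → Carrier) →
    sumFin (suc n) f ≈ f i + sumFin n (f ∘ punchIn i)
  sumFin-remove n i f = begin
    sumFin (suc n) f               ≈⟨ sumFin≈sum _ f ⟩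
    sum f                          ≈⟨ sum-remove f ⟩
    f i + sum (f ∘ punchIn i)      ≈⟨ +-congˡ (sumFin≈sum n _) ⟨
    f i + sumFin n (f ∘ punchIn i) ∎

  linComb : ∀ {r m} → (Fin r → Carrier) → (Fin r → Vect m) → Vect m
  linComb {r} c u x = sumFin r (λ i → c i * u i x)

  dot : ∀ {n} → Vect n → Vect n → Carrier
  dot {n} a v = sumFin n (λ x → a x * v x)

  KernelDim≥ : ∀ {r n} → ℕ → (Fin r → Vect n) → Set
  KernelDim≥ {r} {n} j A = Σ (Fin j → Vect n) λ S → LinIndep S × (∀ s t → dot (A t) (S s) ≈ 0#)

  linComb-linComb : ∀ {k r m} (c : Fin k → Carrier) (L : Fin k → Vect r) (b : Fin r → Vect m) →
    linComb c (λ s → linComb (L s) b) ≈v linComb (linComb c L) b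
  linComb-linComb {k} {r} c L b x = begin
    sumFin k (λ s → c s * sumFin r (λ i → L s i * b i x))
      ≈⟨ sumFin-cong k (λ s → *-distribˡ-sumFin r (c s) _) ⟩
    sumFin k (λ s → sumFin r (λ i → c s * (L s i * b i x)))
      ≈⟨ sumFin-cong k (λ s → sumFin-cong r (λ i → *-assoc _ _ _)) ⟨
    sumFin k (λ s → sumFin r (λ i → c s * L s i * b i x))
      ≈⟨ sumFin-comm k r _ ⟩
    sumFin r (λ i → sumFin k (λ s → c s * L s i * b i x))
      ≈⟨ sumFin-cong r (λ i → *-distribʳ-sumFin k (b i x) _) ⟨
    sumFin r (λ i → sumFin k (λ s → c s * L s i) * b i x)
      ∎

  dot-comm : ∀ {n} (a v : Vect n) → dot a v ≈ dot v a
  dot-comm {n} a v = sumFin-cong n (λ x → *-comm (a x) (v x))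

  dot-congˡ : ∀ {n} {a a' : Vect n} → a ≈v a' → ∀ v → dot a v ≈ dot a' v
  dot-congˡ {n} a≈a' v = sumFin-cong n (λ x → *-congʳ (a≈a' x))

  dot-linComb : ∀ {n r} (a : Vect n) (c : Fin r → Carrier) (u : Fin r → Vect n) →
    dot a (linComb c u) ≈ sumFin r (λ i → c i * dot a (u i))
  dot-linComb {n} {r} a c u = begin
    sumFin n (λ x → a x * sumFin r (λ i → c i * u i x))
      ≈⟨ sumFin-cong n (λ x → *-distribˡ-sumFin r (a x) _) ⟩
    sumFin n (λ x → sumFin r (λ i → a x * (c i * u i x)))
      ≈⟨ sumFin-cong n (λ x → sumFin-cong r (λ i → x∙yz≈y∙xz _ _ _)) ⟩
    sumFin n (λ x → sumFin r (λ i → c i * (a x * u i x)))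
      ≈⟨ sumFin-comm n r _ ⟩
    sumFin r (λ i → sumFin n (λ x → c i * (a x * u i x)))
      ≈⟨ sumFin-cong r (λ i → *-distribˡ-sumFin n (c i) _) ⟨
    sumFin r (λ i → c i * dot a (u i))
      ∎

  dot-annihilates-span : ∀ {n r} (a : Vect n) (u : Fin r → Vect n) → (∀ i → dot a (u i) ≈ 0#) →
    ∀ {v} (c : Fin r → Carrier) → v ≈v linComb c u → dot a v ≈ 0#
  dot-annihilates-span {n} {r} a u a⊥u {v} c v≈c·u = begin
    dot a v                            ≈⟨ sumFin-cong n (λ x → *-congˡ (v≈c·u x)) ⟩
    dot a (linComb c u)                ≈⟨ dot-linComb a c u ⟩
    sumFin r (λ i → c i * dot a (u i)) ≈⟨ sumFin-zero r (λ i → trans (*-congˡ (a⊥u i)) (zeroʳ _)) ⟩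
    0#                                 ∎

  linComb-injective : ∀ {r m} {u : Fin r → Vect m} → LinIndep u →
    ∀ {c c'} → linComb c u ≈v linComb c' u → ∀ i → c i ≈ c' i
  linComb-injective {r} {u = u} u-indep {c} {c'} c·u≈c'·u i =
    x∙y⁻¹≈ε⇒x≈y _ _ (u-indep (λ s → c s - c' s) difference≈0 i)
    where
    difference≈0 : ∀ x → linComb (λ s → c s - c' s) u x ≈ 0#
    difference≈0 x = begin
      sumFin r (λ s → (c s - c' s) * u s x)
        ≈⟨ sumFin-cong r (λ s → [y-z]x≈yx-zx (u s x) (c s) (c' s)) ⟩
      sumFin r (λ s → c s * u s x - c' s * u s x)
        ≈⟨ sumFin-+ r _ _ ⟩
      linComb c u x + sumFin r (λ s → - (c' s * u s x))
        ≈⟨ +-congˡ (sumFin-neg r _) ⟩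
      linComb c u x - linComb c' u x
        ≈⟨ x≈y⇒x∙y⁻¹≈ε (c·u≈c'·u x) ⟩
      0#
        ∎

  e-diagonal : ∀ {m} (i x : Fin m) → toℕ i ≡ toℕ x → e i x ≈ 1#
  e-diagonal i x i≡x with toℕ i ℕ.≟ toℕ x
  ... | yes _   = refl
  ... | no  i≢x = ⊥-elim (i≢x i≡x)

  e-offDiagonal : ∀ {m} (i x : Fin m) → toℕ i ≢ toℕ x → e i x ≈ 0#
  e-offDiagonal i x i≢x with toℕ i ℕ.≟ toℕ x
  ... | yes i≡x = ⊥-elim (i≢x i≡x)
  ... | no  _   = refl

  linComb-e∘-at : ∀ {j m} (g : Fin j → Fin m) → (∀ {s s'} → toℕ (g s) ≡ toℕ (g s') → s ≡ s') →
    ∀ (c : Fin j → Carrier) s → linComb c (e ∘ g) (g s) ≈ c s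
  linComb-e∘-at {suc j} g g-injective c s = begin
    sumFin (suc j) (λ t → c t * e (g t) (g s))
      ≈⟨ sumFin-remove j s (λ t → c t * e (g t) (g s)) ⟩
    c s * e (g s) (g s) + sumFin j (λ t → c (punchIn s t) * e (g (punchIn s t)) (g s))
      ≈⟨ +-cong (*-congˡ (e-diagonal (g s) (g s) ≡.refl)) (sumFin-zero j off-diagonal≈0) ⟩
    c s * 1# + 0#
      ≈⟨ +-identityʳ _ ⟩
    c s * 1#
      ≈⟨ *-identityʳ _ ⟩
    c s
      ∎
    where
    off-diagonal≈0 : ∀ t → c (punchIn s t) * e (g (punchIn s t)) (g s) ≈ 0#
    off-diagonal≈0 t = trans (*-congˡ (e-offDiagonal _ _ (Finₚ.punchInᵢ≢i s t ∘ g-injective))) (zeroʳ _)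

  linComb-e : ∀ {m} (c : Vect m) → linComb c e ≈v c
  linComb-e c = linComb-e∘-at (λ i → i) Finₚ.toℕ-injective c

  dot-e : ∀ {n} (v : Vect n) i → dot v (e i) ≈ v i
  dot-e {n} v i = trans (sumFin-cong n (λ x → *-congˡ (e-symmetric x))) (linComb-e v i)
    where
    e-symmetric : ∀ x → e i x ≈ e x i
    e-symmetric x with toℕ i ℕ.≟ toℕ x
    ... | yes i≡x = sym (e-diagonal x i (≡.sym i≡x))
    ... | no  i≢x = sym (e-offDiagonal x i (i≢x ∘ ≡.sym))

  e∘-linIndep : ∀ {j m} (g : Fin j → Fin m) → (∀ {s s'} → toℕ (g s) ≡ toℕ (g s') → s ≡ s') →
    LinIndep (e ∘ g)
  e∘-linIndep g g-injective c c·eg≈0 s = trans (sym (linComb-e∘-at g g-injective c s)) (c·eg≈0 (g s))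

  e-linIndep : ∀ {m} → LinIndep (e {m})
  e-linIndep = e∘-linIndep (λ i → i) Finₚ.toℕ-injective

  e-spans : ∀ {m} (v : Vect m) → InSpan e v
  e-spans {m} v = v , (λ i m≤i → ⊥-elim (ℕₚ.<⇒≱ (Finₚ.toℕ<n i) m≤i)) , λ x → sym (linComb-e v x)

  InV⇒vanishesFrom : ∀ {m d} {v : Vect m} → InV d v → ∀ x → d ≤ toℕ x → v x ≈ 0#
  InV⇒vanishesFrom (c , c-vanishes , v≈c·e) x d≤x =
    trans (v≈c·e x) (trans (linComb-e c x) (c-vanishes x d≤x))

  vanishesFrom⇒InV : ∀ {m d} {v : Vect m} → (∀ x → d ≤ toℕ x → v x ≈ 0#) → InV d v
  vanishesFrom⇒InV {v = v} v-vanishes = v , v-vanishes , λ x → sym (linComb-e v x)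

  prefix-weaken : ∀ {m r d d'} {u : Fin r → Vect m} {v} → d ≤ d' →
    InSpanPrefix u d v → InSpanPrefix u d' v
  prefix-weaken d≤d' (c , c-vanishes , v≈c·u) =
    c , (λ i d'≤i → c-vanishes i (ℕₚ.≤-trans d≤d' d'≤i)) , v≈c·u

  dimMeetGe-map : ∀ {l m j} {b : Basis l m} {U U' : Vect m → Set} → (∀ v → U v → U' v) →
    DimMeetGe b U j → DimMeetGe b U' j
  dimMeetGe-map U⊆U' (u , u-indep , u∈) = u , u-indep , λ s → proj₁ (u∈ s) , U⊆U' (u s) (proj₂ (u∈ s))

module FieldLinearAlgebra (R : CommutativeRing 0ℓ 0ℓ)
  (0≉1 : ¬ CommutativeRing._≈_ R (CommutativeRing.0# R) (CommutativeRing.1# R))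
  (inv : ∀ x → ¬ CommutativeRing._≈_ R x (CommutativeRing.0# R) → Σ (CommutativeRing.Carrier R) λ y →
    CommutativeRing._≈_ R (CommutativeRing._*_ R x y) (CommutativeRing.1# R))
  (_≟_ : Decidable (CommutativeRing._≈_ R)) where

  open CommutativeRing R
  open LinAlg R
  open RingLinearAlgebra R
  open import Algebra.Properties.Ring ring using (-‿distribˡ-*; -‿distribʳ-*; [y-z]x≈yx-zx)
  open import Algebra.Properties.Group (AbelianGroup.group +-abelianGroup)
    using (inverseˡ-unique; x∙y⁻¹≈ε⇒x≈y; ε⁻¹≈ε)
  open import Relation.Binary.Reasoning.Setoid setoid

  nonzeroEntry⊎zero : ∀ {n} (a : Vect n) → (∃ λ p → ¬ a p ≈ 0#) ⊎ (∀ p → a p ≈ 0#)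
  nonzeroEntry⊎zero a with Finₚ.any? (λ p → ¬? (a p ≟ 0#))
  ... | yes a≉0 = inj₁ a≉0
  ... | no ¬a≉0 = inj₂ (λ p → decidable-stable (a p ≟ 0#) (λ ap≉0 → ¬a≉0 (p , ap≉0)))

  -- For a p invertible, lift identifies F^n with the kernel of a in F^(1+n): lift y is y
  -- with a p-th coordinate inserted so that a vanishes, and pullback b is the functional
  -- y ↦ b (lift y).
  module KernelChart {n} (a : Vect (suc n)) (p : Fin (suc n)) (ap≉0 : ¬ a p ≈ 0#) where

    a⁻¹ : Carrier
    a⁻¹ = proj₁ (inv (a p) ap≉0)

    ap*a⁻¹≈1 : a p * a⁻¹ ≈ 1#
    ap*a⁻¹≈1 = proj₂ (inv (a p) ap≉0)

    private
      insert : Carrier → Vect n → (x : Fin (suc n)) → Dec (p ≡ x) → Carrier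
      insert z y x (yes _)  = z
      insert z y x (no p≢x) = y (punchOut p≢x)

    lift : Vect n → Vect (suc n)
    lift y x = insert (- (a⁻¹ * dot (a ∘ punchIn p) y)) y x (p Finₚ.≟ x)

    lift-pivot : ∀ y → lift y p ≈ - (a⁻¹ * dot (a ∘ punchIn p) y)
    lift-pivot y with p Finₚ.≟ p
    ... | yes _  = refl
    ... | no p≢p = ⊥-elim (p≢p ≡.refl)

    lift-punchIn : ∀ y i → lift y (punchIn p i) ≈ y i
    lift-punchIn y i with p Finₚ.≟ punchIn p i
    ... | yes p≡pᵢ = ⊥-elim (Finₚ.punchInᵢ≢i p i (≡.sym p≡pᵢ))
    ... | no  p≢pᵢ =
      reflexive (≡.cong y (≡.trans (Finₚ.punchOut-cong p ≡.refl) (Finₚ.punchOut-punchIn p)))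

    pullback : Vect (suc n) → Vect n
    pullback b i = b (punchIn p i) - (b p * a⁻¹) * a (punchIn p i)

    dot-lift : ∀ b y → dot b (lift y) ≈ dot (pullback b) y
    dot-lift b y = begin
      dot b (lift y)
        ≈⟨ sumFin-remove n p (λ x → b x * lift y x) ⟩
      b p * lift y p + sumFin n (λ i → b (punchIn p i) * lift y (punchIn p i))
        ≈⟨ +-cong (*-congˡ (lift-pivot y)) (sumFin-cong n (λ i → *-congˡ (lift-punchIn y i))) ⟩
      b p * - (a⁻¹ * T) + dot (b ∘ punchIn p) y
        ≈⟨ trans (+-comm _ _) (+-congˡ (sym (-‿distribʳ-* _ _))) ⟩
      dot (b ∘ punchIn p) y - b p * (a⁻¹ * T)
        ≈⟨ +-congˡ (-‿cong (trans (sym (*-distribˡ-sumFin n _ _)) (*-assoc _ _ _))) ⟨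
      dot (b ∘ punchIn p) y - sumFin n (λ i → b p * a⁻¹ * (a (punchIn p i) * y i))
        ≈⟨ +-congˡ (sumFin-neg n _) ⟨
      dot (b ∘ punchIn p) y + sumFin n (λ i → - (b p * a⁻¹ * (a (punchIn p i) * y i)))
        ≈⟨ sumFin-+ n _ _ ⟨
      sumFin n (λ i → b (punchIn p i) * y i - b p * a⁻¹ * (a (punchIn p i) * y i))
        ≈⟨ sumFin-cong n (λ i → +-congˡ (-‿cong (*-assoc _ _ _))) ⟨
      sumFin n (λ i → b (punchIn p i) * y i - b p * a⁻¹ * a (punchIn p i) * y i)
        ≈⟨ sumFin-cong n (λ i → [y-z]x≈yx-zx (y i) _ _) ⟨
      dot (pullback b) y
        ∎
      where T = dot (a ∘ punchIn p) y

    pullback-self : ∀ i → pullback a i ≈ 0#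
    pullback-self i = begin
      a (punchIn p i) - a p * a⁻¹ * a (punchIn p i) ≈⟨ +-congˡ (-‿cong (*-congʳ ap*a⁻¹≈1)) ⟩
      a (punchIn p i) - 1# * a (punchIn p i)        ≈⟨ +-congˡ (-‿cong (*-identityˡ _)) ⟩
      a (punchIn p i) - a (punchIn p i)             ≈⟨ -‿inverseʳ _ ⟩
      0#                                            ∎

    lift-annihilated : ∀ y → dot a (lift y) ≈ 0#
    lift-annihilated y =
      trans (dot-lift a y) (sumFin-zero n (λ i → trans (*-congʳ (pullback-self i)) (zeroˡ _)))

    lift-cong : ∀ {y y'} → y ≈v y' → lift y ≈v lift y'
    lift-cong {y} {y'} y≈y' x with p Finₚ.≟ x
    ... | yes _  = -‿cong (*-congˡ (sumFin-cong n (λ i → *-congˡ (y≈y' i))))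
    ... | no p≢x = y≈y' (punchOut p≢x)

    lift-restrict : ∀ {v} → dot a v ≈ 0# → v ≈v lift (v ∘ punchIn p)
    lift-restrict {v} a·v≈0 =
      punchIn-elim p (sym (trans (lift-pivot _) -a⁻¹T≈vp)) (λ i → sym (lift-punchIn _ i))
      where
      T = dot (a ∘ punchIn p) (v ∘ punchIn p)
      ap*vp≈-T : a p * v p ≈ - T
      ap*vp≈-T = inverseˡ-unique _ _ (trans (sym (sumFin-remove n p (λ x → a x * v x))) a·v≈0)
      -a⁻¹T≈vp : - (a⁻¹ * T) ≈ v p
      -a⁻¹T≈vp = begin
        - (a⁻¹ * T)         ≈⟨ -‿distribʳ-* a⁻¹ T ⟩
        a⁻¹ * - T           ≈⟨ *-congˡ ap*vp≈-T ⟨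
        a⁻¹ * (a p * v p)   ≈⟨ *-assoc _ _ _ ⟨
        a⁻¹ * a p * v p     ≈⟨ *-congʳ (trans (*-comm _ _) ap*a⁻¹≈1) ⟩
        1# * v p            ≈⟨ *-identityˡ _ ⟩
        v p                 ∎

    kernel-ext : ∀ {v v'} → dot a v ≈ 0# → dot a v' ≈ 0# →
      (∀ i → v (punchIn p i) ≈ v' (punchIn p i)) → v ≈v v'
    kernel-ext {v} {v'} a·v≈0 a·v'≈0 v≈v' x = begin
      v x                      ≈⟨ lift-restrict a·v≈0 x ⟩
      lift (v ∘ punchIn p) x   ≈⟨ lift-cong v≈v' x ⟩
      lift (v' ∘ punchIn p) x  ≈⟨ lift-restrict a·v'≈0 x ⟨
      v' x                     ∎

    lift-linComb : ∀ {r} (c : Fin r → Carrier) (ys : Fin r → Vect n) →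
      lift (linComb c ys) ≈v linComb c (lift ∘ ys)
    lift-linComb {r} c ys = kernel-ext (lift-annihilated _)
      (dot-annihilates-span a (lift ∘ ys) (lift-annihilated ∘ ys) c (λ _ → refl))
      (λ i → trans (lift-punchIn _ i) (sumFin-cong r (λ s → *-congˡ (sym (lift-punchIn (ys s) i)))))

    lift-linIndep : ∀ {r} {ys : Fin r → Vect n} → LinIndep ys → LinIndep (lift ∘ ys)
    lift-linIndep {r} {ys} ys-indep c c·lift≈0 = ys-indep c (λ i →
      trans (sumFin-cong r (λ s → *-congˡ (sym (lift-punchIn (ys s) i)))) (c·lift≈0 (punchIn p i)))

    pullback≈dot-lift : ∀ b i → pullback b i ≈ dot b (lift (e i))
    pullback≈dot-lift b i = sym (trans (dot-lift b (e i)) (dot-e (pullback b) i))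

    pullback-linComb : ∀ {r} (c : Fin r → Carrier) (B : Fin r → Vect (suc n)) →
      pullback (linComb c B) ≈v linComb c (pullback ∘ B)
    pullback-linComb {r} c B i = begin
      pullback (linComb c B) i                      ≈⟨ pullback≈dot-lift (linComb c B) i ⟩
      dot (linComb c B) (lift (e i))                ≈⟨ dot-comm (linComb c B) (lift (e i)) ⟩
      dot (lift (e i)) (linComb c B)                ≈⟨ dot-linComb (lift (e i)) c B ⟩
      sumFin r (λ s → c s * dot (lift (e i)) (B s)) ≈⟨ sumFin-cong r (λ s → *-congˡ (B-pullback s)) ⟩
      linComb c (pullback ∘ B) i                    ∎
      where
      B-pullback : ∀ s → dot (lift (e i)) (B s) ≈ pullback (B s) i
      B-pullback s = trans (dot-comm (lift (e i)) (B s)) (sym (pullback≈dot-lift (B s) i))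

    pullback≈0⇒proportional : ∀ {b} → (∀ i → pullback b i ≈ 0#) → ∀ x → b x ≈ b p * a⁻¹ * a x
    pullback≈0⇒proportional {b} pb≈0 = punchIn-elim p (sym (begin
      b p * a⁻¹ * a p   ≈⟨ *-assoc _ _ _ ⟩
      b p * (a⁻¹ * a p) ≈⟨ *-congˡ (trans (*-comm _ _) ap*a⁻¹≈1) ⟩
      b p * 1#          ≈⟨ *-identityʳ _ ⟩
      b p               ∎)) (λ i → x∙y⁻¹≈ε⇒x≈y _ _ (pb≈0 i))

    dot-pullback-restrict : ∀ b {v} → dot a v ≈ 0# → dot (pullback b) (v ∘ punchIn p) ≈ dot b v
    dot-pullback-restrict b {v} a·v≈0 = begin
      dot (pullback b) (v ∘ punchIn p) ≈⟨ dot-lift b _ ⟨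
      dot b (lift (v ∘ punchIn p))     ≈⟨ dot-comm b (lift (v ∘ punchIn p)) ⟩
      dot (lift (v ∘ punchIn p)) b     ≈⟨ dot-congˡ (lift-restrict {v} a·v≈0) b ⟨
      dot v b                          ≈⟨ dot-comm v b ⟩
      dot b v                          ∎

  kernelDim≥-dropZeroRow : ∀ {r n j} (A : Fin (suc r) → Vect n) → (∀ x → A fz x ≈ 0#) →
    KernelDim≥ j (A ∘ fs) → KernelDim≥ j A
  kernelDim≥-dropZeroRow {n = n} A A₀≈0 (S , S-indep , S⊥) = S , S-indep , λ where
    s fz     → sumFin-zero n (λ x → trans (*-congʳ (A₀≈0 x)) (zeroˡ (S s x)))
    s (fs t) → S⊥ s t

  kernelDim≥-pivot : ∀ {r n j} (A : Fin (suc r) → Vect (suc n)) p (A₀p≉0 : ¬ A fz p ≈ 0#) →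
    KernelDim≥ j (KernelChart.pullback (A fz) p A₀p≉0 ∘ A ∘ fs) → KernelDim≥ j A
  kernelDim≥-pivot A p A₀p≉0 (S , S-indep , S⊥) = lift ∘ S , lift-linIndep S-indep , S⊥′
    where
    open KernelChart (A fz) p A₀p≉0
    S⊥′ : ∀ s t → dot (A t) (lift (S s)) ≈ 0#
    S⊥′ s fz     = lift-annihilated (S s)
    S⊥′ s (fs t) = trans (dot-lift (A (fs t)) (S s)) (S⊥ s t)

  kernelDim≥-fewRows : ∀ {r n} j (A : Fin r → Vect n) → j ℕ.+ r ≤ n → KernelDim≥ j A
  kernelDim≥-fewRows {zero} j A j+0≤n =
    e ∘ inject , e∘-linIndep inject inject-injective , λ s ()
    where
    j≤n = ℕₚ.≤-trans (ℕₚ.m≤m+n j 0) j+0≤n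
    inject = λ s → Fin.inject≤ s j≤n
    inject-injective : ∀ {s s'} → toℕ (inject s) ≡ toℕ (inject s') → s ≡ s'
    inject-injective {s} {s'} eq = Finₚ.toℕ-injective
      (≡.trans (≡.sym (Finₚ.toℕ-inject≤ s j≤n)) (≡.trans eq (Finₚ.toℕ-inject≤ s' j≤n)))
  kernelDim≥-fewRows {suc r} {zero} j A j+1+r≤0 =
    ⊥-elim (ℕₚ.≤⇒≯ j+1+r≤0 (ℕₚ.<-≤-trans ℕₚ.0<1+n (ℕₚ.m≤n+m _ j)))
  kernelDim≥-fewRows {suc r} {suc n} j A j+1+r≤1+n with nonzeroEntry⊎zero (A fz)
  ... | inj₂ A₀≈0 = kernelDim≥-dropZeroRow A A₀≈0
        (kernelDim≥-fewRows j (A ∘ fs) (ℕₚ.≤-trans (ℕₚ.+-monoʳ-≤ j (ℕₚ.n≤1+n r)) j+1+r≤1+n))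
  ... | inj₁ (p , A₀p≉0) = kernelDim≥-pivot A p A₀p≉0
        (kernelDim≥-fewRows j _ (ℕₚ.≤-pred (≡.subst (_≤ suc n) (ℕₚ.+-suc j r) j+1+r≤1+n)))

  x*y≈0⇒y≈0 : ∀ {x y} → ¬ x ≈ 0# → x * y ≈ 0# → y ≈ 0#
  x*y≈0⇒y≈0 {x} {y} x≉0 xy≈0 = begin
    y                           ≈⟨ *-identityˡ y ⟨
    1# * y                      ≈⟨ *-congʳ (trans (*-comm _ _) (proj₂ (inv x x≉0))) ⟨
    proj₁ (inv x x≉0) * x * y   ≈⟨ *-assoc _ _ _ ⟩
    proj₁ (inv x x≉0) * (x * y) ≈⟨ *-congˡ xy≈0 ⟩
    proj₁ (inv x x≉0) * 0#      ≈⟨ zeroʳ _ ⟩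
    0#                          ∎

  pullback-linIndep : ∀ {k n} (Λ : Fin (suc k) → Vect (suc n)) p (Λ₀p≉0 : ¬ Λ fz p ≈ 0#) →
    LinIndep Λ → LinIndep (KernelChart.pullback (Λ fz) p Λ₀p≉0 ∘ Λ ∘ fs)
  pullback-linIndep {k} Λ p Λ₀p≉0 Λ-indep c c·Λ′≈0 s = Λ-indep c̃ c̃·Λ≈0 (fs s)
    where
    open KernelChart (Λ fz) p Λ₀p≉0
    b = linComb c (Λ ∘ fs)
    c̃ : Fin (suc k) → Carrier
    c̃ fz     = - (b p * a⁻¹)
    c̃ (fs s) = c s
    b∝Λ₀ : ∀ x → b x ≈ b p * a⁻¹ * Λ fz x
    b∝Λ₀ = pullback≈0⇒proportional (λ i → trans (pullback-linComb c (Λ ∘ fs) i) (c·Λ′≈0 i))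
    c̃·Λ≈0 : ∀ x → linComb c̃ Λ x ≈ 0#
    c̃·Λ≈0 x = begin
      - (b p * a⁻¹) * Λ fz x + b x                ≈⟨ +-congʳ (sym (-‿distribˡ-* _ _)) ⟩
      - (b p * a⁻¹ * Λ fz x) + b x                ≈⟨ +-congˡ (b∝Λ₀ x) ⟩
      - (b p * a⁻¹ * Λ fz x) + b p * a⁻¹ * Λ fz x ≈⟨ -‿inverseˡ _ ⟩
      0#                                          ∎

  annihilated-pivotRow : ∀ {l a} (A : Fin (suc l) → Vect a) (λ₀ : Vect (suc l)) p → ¬ λ₀ p ≈ 0# →
    (∀ x → linComb λ₀ A x ≈ 0#) →
    ∀ {v} → (∀ r → dot (A (punchIn p r)) v ≈ 0#) → dot (A p) v ≈ 0#
  annihilated-pivotRow {l} {a} A λ₀ p λ₀p≉0 λ₀·A≈0 {v} A·v≈0 = x*y≈0⇒y≈0 λ₀p≉0 (begin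
    λ₀ p * dot (A p) v
      ≈⟨ +-identityʳ _ ⟨
    λ₀ p * dot (A p) v + 0#
      ≈⟨ +-congˡ (sumFin-zero l (λ r → trans (*-congˡ (A·v≈0 r)) (zeroʳ _))) ⟨
    λ₀ p * dot (A p) v + sumFin l (λ r → λ₀ (punchIn p r) * dot (A (punchIn p r)) v)
      ≈⟨ sumFin-remove l p (λ r → λ₀ r * dot (A r) v) ⟨
    sumFin (suc l) (λ r → λ₀ r * dot (A r) v)
      ≈⟨ sumFin-cong (suc l) (λ r → *-congˡ {λ₀ r} (dot-comm (A r) v)) ⟩
    sumFin (suc l) (λ r → λ₀ r * dot v (A r))
      ≈⟨ dot-linComb v λ₀ A ⟨
    dot v (linComb λ₀ A)
      ≈⟨ sumFin-zero a (λ x → trans (*-congˡ (λ₀·A≈0 x)) (zeroʳ _)) ⟩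
    0#
      ∎)

  linIndep⇒nonzero : ∀ {k n} {Λ : Fin (suc k) → Vect n} → LinIndep Λ → ¬ (∀ x → Λ fz x ≈ 0#)
  linIndep⇒nonzero {k} {n} {Λ} Λ-indep Λ₀≈0 = 0≉1 (sym (Λ-indep δ₀ δ₀·Λ≈0 fz))
    where
    δ₀ : Fin (suc k) → Carrier
    δ₀ fz     = 1#
    δ₀ (fs _) = 0#
    δ₀·Λ≈0 : ∀ x → linComb δ₀ Λ x ≈ 0#
    δ₀·Λ≈0 x = begin
      1# * Λ fz x + sumFin k (λ s → 0# * Λ (fs s) x)
        ≈⟨ +-cong (trans (*-identityˡ _) (Λ₀≈0 x)) (sumFin-zero k (λ s → zeroˡ _)) ⟩
      0# + 0#
        ≈⟨ +-identityʳ 0# ⟩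
      0#
        ∎

  -- The relation Λ₀ expresses a row A p through the others; dropping it and pulling the
  -- remaining relations back along the chart of Λ₀ leaves k − 1 independent relations.
  kernelDim≥-relatedRows : ∀ {k l a} j (A : Fin l → Vect a) (Λ : Fin k → Vect l) → LinIndep Λ →
    (∀ s x → linComb (Λ s) A x ≈ 0#) → j ℕ.+ (l ∸ k) ≤ a → KernelDim≥ j A
  kernelDim≥-relatedRows {zero} j A Λ _ _ j+l≤a = kernelDim≥-fewRows j A j+l≤a
  kernelDim≥-relatedRows {suc k} {zero} j A Λ Λ-indep _ _ =
    ⊥-elim (linIndep⇒nonzero {Λ = Λ} Λ-indep (λ ()))
  kernelDim≥-relatedRows {suc k} {suc l} j A Λ Λ-indep Λ·A≈0 bound with nonzeroEntry⊎zero (Λ fz)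
  ... | inj₂ Λ₀≈0 = ⊥-elim (linIndep⇒nonzero {Λ = Λ} Λ-indep Λ₀≈0)
  ... | inj₁ (p , Λ₀p≉0) = S , S-indep , S⊥
    where
    open KernelChart (Λ fz) p Λ₀p≉0
    column : ∀ x → Vect (suc l)
    column x r = A r x
    Λ′ = pullback ∘ Λ ∘ fs
    Λ′·A′≈0 : ∀ s x → linComb (Λ′ s) (A ∘ punchIn p) x ≈ 0#
    Λ′·A′≈0 s x =
      trans (dot-pullback-restrict (Λ (fs s)) {column x} (Λ·A≈0 fz x)) (Λ·A≈0 (fs s) x)
    reduced = kernelDim≥-relatedRows j (A ∘ punchIn p) Λ′
      (pullback-linIndep Λ p Λ₀p≉0 Λ-indep) Λ′·A′≈0 bound
    S = proj₁ reduced
    S-indep = proj₁ (proj₂ reduced)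
    A′·S≈0 = proj₂ (proj₂ reduced)
    S⊥ : ∀ s r → dot (A r) (S s) ≈ 0#
    S⊥ s = punchIn-elim p (annihilated-pivotRow A (Λ fz) p Λ₀p≉0 (Λ·A≈0 fz) (A′·S≈0 s)) (A′·S≈0 s)

  dimMeet≥ : ∀ {l m p} d j (w : Fin p → Vect m) (b : Basis l m) → LinIndep b →
    (∀ r → InSpan w (b r)) → d ≤ p → (p ∸ d) ℕ.+ j ≤ l → DimMeetGe b (InSpanPrefix w d) j
  dimMeet≥ {l} {m} {p} d j w b b-indep b∈w d≤p codim+j≤l = u , u-indep , λ s → u∈L s , u∈W_d s
    where
    C : Fin l → Fin p → Carrier
    C r = proj₁ (b∈w r)
    A : Fin (p ∸ d) → Vect l
    A t r = C r (shiftBy d≤p t)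
    kernel = kernelDim≥-fewRows j A (≡.subst (_≤ l) (ℕₚ.+-comm (p ∸ d) j) codim+j≤l)
    Lm = proj₁ kernel
    u : Fin j → Vect m
    u s = linComb (Lm s) b
    u∈L : ∀ s → InSpan b (u s)
    u∈L s = Lm s , (λ r l≤r → ⊥-elim (ℕₚ.<⇒≱ (Finₚ.toℕ<n r) l≤r)) , (λ x → refl)
    μ : Fin j → Fin p → Carrier
    μ s = linComb (Lm s) C
    μ-vanishes : ∀ s i → d ≤ toℕ i → μ s i ≈ 0#
    μ-vanishes s i d≤i with shiftBy-surjective d≤p i d≤i
    ... | t , ≡.refl = trans (dot-comm (Lm s) (A t)) (proj₂ (proj₂ kernel) s t)
    u∈W_d : ∀ s → InSpanPrefix w d (u s)
    u∈W_d s = μ s , μ-vanishes s , λ x →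
      trans (sumFin-cong l (λ r → *-congˡ (proj₂ (proj₂ (b∈w r)) x))) (linComb-linComb (Lm s) C w x)
    u-indep : LinIndep u
    u-indep c c·u≈0 =
      proj₁ (proj₂ kernel) c (b-indep _ (λ x → trans (sym (linComb-linComb c Lm b x)) (c·u≈0 x)))

  -- φ vanishes on the first d coordinates and the pivot p lies beyond them, so the first d
  -- vectors of this basis of ker φ are e_0, …, e_(d−1).
  module Hyperplane {m} (φ : Vect (suc m)) (p : Fin (suc m)) (φp≉0 : ¬ φ p ≈ 0#)
    {d} (d≤p : d ≤ toℕ p) (φ-vanishes : ∀ x → toℕ x < d → φ x ≈ 0#) where

    open KernelChart φ p φp≉0

    basis : Fin m → Vect (suc m)
    basis = lift ∘ e

    basis-linIndep : LinIndep basis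
    basis-linIndep = lift-linIndep e-linIndep

    kernel⇒span : ∀ {v} → dot φ v ≈ 0# → InSpanPrefix basis m v
    kernel⇒span {v} φ·v≈0 =
      v ∘ punchIn p , (λ i m≤i → ⊥-elim (ℕₚ.<⇒≱ (Finₚ.toℕ<n i) m≤i)) , λ x → begin
      v x                                  ≈⟨ lift-restrict φ·v≈0 x ⟩
      lift (v ∘ punchIn p) x               ≈⟨ lift-cong (λ i → sym (linComb-e (v ∘ punchIn p) i)) x ⟩
      lift (linComb (v ∘ punchIn p) e) x   ≈⟨ lift-linComb (v ∘ punchIn p) e x ⟩
      linComb (v ∘ punchIn p) basis x      ∎

    span⇒kernel : ∀ {v} → InSpanPrefix basis m v → dot φ v ≈ 0#
    span⇒kernel (c , _ , v≈c·basis) =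
      dot-annihilates-span φ basis (lift-annihilated ∘ e) c v≈c·basis

    basis-vanishesFrom : ∀ t x → toℕ t < d → toℕ t < toℕ x → basis t x ≈ 0#
    basis-vanishesFrom t x t<d =
      punchIn-elim {P = λ x → toℕ t < toℕ x → basis t x ≈ 0#} p at-pivot at-punchIn x
      where
      t<p = ℕₚ.<-≤-trans t<d d≤p
      t≡pᵢt = toℕ-punchIn-< p t t<p
      at-pivot : toℕ t < toℕ p → basis t p ≈ 0#
      at-pivot _ = begin
        lift (e t) p                           ≈⟨ lift-pivot (e t) ⟩
        - (a⁻¹ * dot (φ ∘ punchIn p) (e t))   ≈⟨ -‿cong (*-congˡ (dot-e (φ ∘ punchIn p) t)) ⟩
        - (a⁻¹ * φ (punchIn p t))
          ≈⟨ -‿cong (*-congˡ (φ-vanishes _ (≡.subst (_< d) (≡.sym t≡pᵢt) t<d))) ⟩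
        - (a⁻¹ * 0#)                          ≈⟨ -‿cong (zeroʳ _) ⟩
        - 0#                                  ≈⟨ ε⁻¹≈ε ⟩
        0#                                    ∎
      at-punchIn : ∀ y → toℕ t < toℕ (punchIn p y) → basis t (punchIn p y) ≈ 0#
      at-punchIn y t<x = trans (lift-punchIn (e t) y) (e-offDiagonal t y t≢y)
        where
        t≢y : toℕ t ≢ toℕ y
        t≢y t≡y = ℕₚ.<⇒≢ t<x
          (≡.trans t≡y (≡.sym (toℕ-punchIn-< p y (≡.subst (_< toℕ p) t≡y t<p))))

    prefix⇒InV : ∀ {d' v} → d' ≤ d → InSpanPrefix basis d' v → InV d' v
    prefix⇒InV {d'} {v} d'≤d (c , c-vanishes , v≈c·basis) = vanishesFrom⇒InV λ x d'≤x →
      trans (v≈c·basis x) (sumFin-zero m (λ t → term≈0 t x d'≤x))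
      where
      term≈0 : ∀ t x → d' ≤ toℕ x → c t * basis t x ≈ 0#
      term≈0 t x d'≤x with toℕ t ℕ.<? d'
      ... | yes t<d' = trans (*-congˡ (basis-vanishesFrom t x t<d t<x)) (zeroʳ _)
        where
        t<d = ℕₚ.<-≤-trans t<d' d'≤d
        t<x = ℕₚ.<-≤-trans t<d' d'≤x
      ... | no  t≮d' = trans (*-congʳ (c-vanishes t (ℕₚ.≮⇒≥ t≮d'))) (zeroˡ _)

    InV⇒prefix : ∀ {d' v} → d' ≤ d → InV d' v → InSpanPrefix basis d' v
    InV⇒prefix {d'} {v} d'≤d v∈V =
      c , (λ i d'≤i → InV⇒vanishesFrom v∈V (punchIn p i) (ℕₚ.≤-trans d'≤i (toℕ≤toℕ-punchIn p i)))
        , v≈c·basis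
      where
      φ·v≈0 : dot φ v ≈ 0#
      φ·v≈0 = sumFin-zero (suc m) λ x → case toℕ x ℕ.<? d' of λ where
        (yes x<d') → trans (*-congʳ (φ-vanishes x (ℕₚ.<-≤-trans x<d' d'≤d))) (zeroˡ _)
        (no  x≮d') → trans (*-congˡ (InV⇒vanishesFrom v∈V x (ℕₚ.≮⇒≥ x≮d'))) (zeroʳ _)
      spanned = kernel⇒span φ·v≈0
      c = proj₁ spanned
      v≈c·basis = proj₂ (proj₂ spanned)

module Enumeration (S : Setoid 0ℓ 0ℓ) {q} (card : HasCard (Setoid._≈_ S) (λ _ → ⊤) q) where

  open Setoid S renaming (Carrier to A)

  private
    xs : List.List A
    xs = proj₁ card
    length≡q : List.length xs ≡ q
    length≡q = proj₁ (proj₂ card)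
    distinct : AllPairs (λ x y → ¬ x ≈ y) xs
    distinct = proj₁ (proj₂ (proj₂ (proj₂ card)))
    complete : ∀ x → ⊤ → Any.Any (x ≈_) xs
    complete = proj₂ (proj₂ (proj₂ (proj₂ card)))

    lookup-injective : ∀ {ys} → AllPairs (λ x y → ¬ x ≈ y) ys →
      ∀ i j → List.lookup ys i ≈ List.lookup ys j → i ≡ j
    lookup-injective (_ ∷ _)    fz     fz     _  = ≡.refl
    lookup-injective (y≉ ∷ _)   fz     (fs j) eq = ⊥-elim (All.lookup y≉ (∈-lookup j) eq)
    lookup-injective (y≉ ∷ _)   (fs i) fz     eq = ⊥-elim (All.lookup y≉ (∈-lookup i) (sym eq))
    lookup-injective (_ ∷ dist) (fs i) (fs j) eq = ≡.cong fs (lookup-injective dist i j eq)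

  enum : Fin q → A
  enum i = List.lookup xs (Fin.cast (≡.sym length≡q) i)

  enum-surjective : ∀ x → ∃ λ i → x ≈ enum i
  enum-surjective x = Fin.cast length≡q (Any.index x∈xs) , trans (Anyₚ.lookup-index x∈xs)
    (reflexive (≡.cong (List.lookup xs) (≡.sym (Finₚ.cast-involutive (≡.sym length≡q) length≡q _))))
    where x∈xs = complete x tt

  enum-injective : ∀ {i j} → enum i ≈ enum j → i ≡ j
  enum-injective {i} {j} eq = Finₚ.toℕ-injective (begin
    toℕ i              ≡⟨ Finₚ.toℕ-cast _ i ⟨
    toℕ (Fin.cast _ i) ≡⟨ ≡.cong toℕ (lookup-injective distinct _ _ eq) ⟩
    toℕ (Fin.cast _ j) ≡⟨ Finₚ.toℕ-cast _ j ⟩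
    toℕ j              ∎)
    where open ≡.≡-Reasoning

  _≟_ : Decidable _≈_
  x ≟ y with enum-surjective x | enum-surjective y
  ... | i , x≈i | j , y≈j with i Finₚ.≟ j
  ...   | yes ≡.refl = yes (trans x≈i (sym y≈j))
  ...   | no  i≢j    = no λ x≈y → i≢j (enum-injective (trans (sym x≈i) (trans x≈y y≈j)))

  enumVec : ∀ d → Fin (q ^ d) → (Fin d → A)
  enumVec zero    _ ()
  enumVec (suc d) t = enum (proj₁ (quotRem t)) ∷ᵥ enumVec d (proj₂ (quotRem t))
    where quotRem = Fin.remQuot {q} (q ^ d)

  enumVec-surjective : ∀ d (v : Fin d → A) → ∃ λ t → ∀ i → v i ≈ enumVec d t i
  enumVec-surjective zero    v = fz , λ ()
  enumVec-surjective (suc d) v = Fin.combine {q} {q ^ d} i t , λ x → trans (v≈ x)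
    (reflexive (≡.cong (λ (i , t) → (enum i ∷ᵥ enumVec d t) x) (≡.sym (Finₚ.remQuot-combine i t))))
    where
    i = proj₁ (enum-surjective (v fz))
    t = proj₁ (enumVec-surjective d (v ∘ fs))
    v≈ : ∀ x → v x ≈ (enum i ∷ᵥ enumVec d t) x
    v≈ fz     = proj₂ (enum-surjective (v fz))
    v≈ (fs y) = proj₂ (enumVec-surjective d (v ∘ fs)) y

  enumVec-injective : ∀ d {t t'} → (∀ i → enumVec d t i ≈ enumVec d t' i) → t ≡ t'
  enumVec-injective zero    {fz} {fz} _ = ≡.refl
  enumVec-injective (suc d) {t} {t'} eq = begin
    t
      ≡⟨ Finₚ.combine-remQuot {q} (q ^ d) t ⟨
    Fin.combine (proj₁ (quotRem t)) (proj₂ (quotRem t))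
      ≡⟨ ≡.cong₂ Fin.combine (enum-injective (eq fz)) (enumVec-injective d (eq ∘ fs)) ⟩
    Fin.combine (proj₁ (quotRem t')) (proj₂ (quotRem t'))
      ≡⟨ Finₚ.combine-remQuot {q} (q ^ d) t' ⟩
    t'
      ∎
    where
    open ≡.≡-Reasoning
    quotRem = Fin.remQuot {q} (q ^ d)

module Counting where

  open import Algebra.Properties.CommutativeMonoid.Sum ℕₚ.+-0-commutativeMonoid public
    using (sum)
  open import Algebra.Properties.CommutativeMonoid.Sum ℕₚ.+-0-commutativeMonoid
    using (sum-remove; ∑-distrib-+; sum-replicate-zero; sum-cong-≗)
  open ℕₚ.≤-Reasoning

  indicator : ∀ {P : Set} → Dec P → ℕ
  indicator (yes _) = 1
  indicator (no _)  = 0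

  count : ∀ {n} {P : Fin n → Set} → Decidable₁ P → ℕ
  count P? = sum (λ t → indicator (P? t))

  sumList : ∀ {B : Set} → (B → ℕ) → List.List B → ℕ
  sumList f = ListAction.sum ∘ List.map f

  injection≤count : ∀ {n' n} {P : Fin n → Set} (P? : Decidable₁ P) (g : Fin n' → Fin n) →
    (∀ {s s'} → g s ≡ g s' → s ≡ s') → (∀ s → P (g s)) → n' ≤ count P?
  injection≤count {zero}          P? g g-inj g∈P = z≤n
  injection≤count {suc n'} {zero} P? g g-inj g∈P with () ← g fz
  injection≤count {suc n'} {suc n} {P} P? g g-inj g∈P = begin
    suc n'
      ≤⟨ s≤s (injection≤count (P? ∘ punchIn g₀) g′ g′-inj g′∈P) ⟩
    suc (count (P? ∘ punchIn g₀))
      ≡⟨ ≡.cong (ℕ._+ count (P? ∘ punchIn g₀)) (≡.sym (indicator-yes (g∈P fz))) ⟩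
    indicator (P? g₀) ℕ.+ count (P? ∘ punchIn g₀)
      ≡⟨ sum-remove (λ t → indicator (P? t)) ⟨
    count P?
      ∎
    where
    g₀ = g fz
    g₀≢ : ∀ s → g₀ ≢ g (fs s)
    g₀≢ s eq with () ← g-inj eq
    g′ : Fin n' → Fin n
    g′ s = punchOut (g₀≢ s)
    punchIn-g′ : ∀ s → punchIn g₀ (g′ s) ≡ g (fs s)
    punchIn-g′ s = Finₚ.punchIn-punchOut (g₀≢ s)
    g′-inj : ∀ {s s'} → g′ s ≡ g′ s' → s ≡ s'
    g′-inj {s} {s'} eq = Finₚ.suc-injective (g-inj
      (≡.trans (≡.sym (punchIn-g′ s)) (≡.trans (≡.cong (punchIn g₀) eq) (punchIn-g′ s'))))
    g′∈P : ∀ s → P (punchIn g₀ (g′ s))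
    g′∈P s = ≡.subst P (≡.sym (punchIn-g′ s)) (g∈P (fs s))
    indicator-yes : ∀ {t} → P t → indicator (P? t) ≡ 1
    indicator-yes {t} Pt with P? t
    ... | yes _  = ≡.refl
    ... | no ¬Pt = ⊥-elim (¬Pt Pt)

  length-filter-∷ : ∀ {B : Set} {P : B → Set} (P? : Decidable₁ P) y ys →
    List.length (List.filter P? (y List.∷ ys)) ≡ indicator (P? y) ℕ.+ List.length (List.filter P? ys)
  length-filter-∷ P? y ys with P? y
  ... | yes _ = ≡.refl
  ... | no  _ = ≡.refl

  double-counting : ∀ {B : Set} {n} {D : Fin n → B → Set} (D? : ∀ t → Decidable₁ (D t)) ys →
    sum (λ t → List.length (List.filter (D? t) ys)) ≡ sumList (λ y → count (λ t → D? t y)) ys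
  double-counting {n = n} D? List.[] = sum-replicate-zero n
  double-counting {n = n} D? (y List.∷ ys) = begin-equality
    sum (λ t → List.length (List.filter (D? t) (y List.∷ ys)))
      ≡⟨ sum-cong-≗ (λ t → length-filter-∷ (D? t) y ys) ⟩
    sum (λ t → indicator (D? t y) ℕ.+ List.length (List.filter (D? t) ys))
      ≡⟨ ∑-distrib-+ (λ t → indicator (D? t y)) _ ⟩
    count (λ t → D? t y) ℕ.+ sum (λ t → List.length (List.filter (D? t) ys))
      ≡⟨ ≡.cong (count (λ t → D? t y) ℕ.+_) (double-counting D? ys) ⟩
    sumList (λ y → count (λ t → D? t y)) (y List.∷ ys)
      ∎

  length*≤sumList : ∀ {B : Set} {f : B → ℕ} {K} ys → All.All (λ y → K ≤ f y) ys →
    List.length ys ℕ.* K ≤ sumList f ys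
  length*≤sumList List.[]       All.[]           = z≤n
  length*≤sumList (y List.∷ ys) (K≤fy All.∷ K≤f) = ℕₚ.+-mono-≤ K≤fy (length*≤sumList ys K≤f)

  sum≤ : ∀ {n} (f : Fin n → ℕ) {M} → (∀ t → f t ≤ M) → sum f ≤ n ℕ.* M
  sum≤ {zero}  f f≤M = z≤n
  sum≤ {suc n} f f≤M = ℕₚ.+-mono-≤ (f≤M fz) (sum≤ (f ∘ fs) (f≤M ∘ fs))

  sum≤-except : ∀ {n} (f : Fin n → ℕ) t₀ {M} → (∀ t → t ≢ t₀ → f t ≤ M) →
    sum f ≤ f t₀ ℕ.+ (n ∸ 1) ℕ.* M
  sum≤-except {suc n} f t₀ {M} f≤M = begin
    sum f                         ≡⟨ sum-remove f ⟩
    f t₀ ℕ.+ sum (f ∘ punchIn t₀) ≤⟨ ℕₚ.+-monoʳ-≤ (f t₀) (sum≤ _ f≤M-off-t₀) ⟩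
    f t₀ ℕ.+ n ℕ.* M              ∎
    where
    f≤M-off-t₀ : ∀ t → f (punchIn t₀ t) ≤ M
    f≤M-off-t₀ t = f≤M _ (Finₚ.punchInᵢ≢i t₀ t)

m*n≤m+o⇒m*[n∸1]≤o : ∀ m n o → m ℕ.* n ≤ m ℕ.+ o → m ℕ.* (n ∸ 1) ≤ o
m*n≤m+o⇒m*[n∸1]≤o m n o m*n≤m+o = begin
  m ℕ.* (n ∸ 1)     ≡⟨ ℕₚ.*-distribˡ-∸ m n 1 ⟩
  m ℕ.* n ∸ m ℕ.* 1 ≡⟨ ≡.cong (m ℕ.* n ∸_) (ℕₚ.*-identityʳ m) ⟩
  m ℕ.* n ∸ m       ≤⟨ ℕₚ.∸-monoˡ-≤ m m*n≤m+o ⟩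
  m ℕ.+ o ∸ m       ≡⟨ ℕₚ.m+n∸m≡n m o ⟩
  o                 ∎
  where open ℕₚ.≤-Reasoning

pred-∸-pred : ∀ y {x} → 1 ≤ x → y ∸ (x ∸ 1) ≡ suc y ∸ x
pred-∸-pred y {suc x} _ = ≡.refl

alpha'-≤ : ∀ k α j → j ≤ k → alpha' k α j ≡ α j
alpha'-≤ k α j j≤k with j ℕ.≤ᵇ k | ℕₚ.≤⇒≤ᵇ j≤k
... | true | _ = ≡.refl

alpha'-> : ∀ k α j → k < j → alpha' k α j ≡ α j ∸ 1
alpha'-> k α j k<j with j ℕ.≤ᵇ k in j≤ᵇk
... | false = ≡.refl
... | true  = ⊥-elim (ℕₚ.<⇒≱ k<j (ℕₚ.≤ᵇ⇒≤ j k (≡.subst Bool.T (≡.sym j≤ᵇk) tt)))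

module IndexFacts {l m : ℕ} {α : ℕ → ℕ} (α∈I : InI l m α) (αl≡m : α l ≡ m)
  {k : ℕ} (k-isK : IsK l α k) where

  open ℕₚ.≤-Reasoning

  private
    α-step : ∀ i → 1 ≤ i → i < l → α i < α (suc i)
    α-step = proj₂ (proj₂ α∈I)
    1≤k : 1 ≤ k
    1≤k = proj₁ k-isK
    k<l : k < l
    k<l = proj₁ (proj₂ k-isK)
    gap-at-k : 2 ℕ.+ α k ≤ α (suc k)
    gap-at-k = proj₁ (proj₂ (proj₂ k-isK))
    no-gap-after-k : ∀ j → k < j → j < l → α (suc j) < 2 ℕ.+ α j
    no-gap-after-k = proj₂ (proj₂ (proj₂ k-isK))

    α-mono-+ : ∀ d i → 1 ≤ i → i ℕ.+ d ≤ l → α i ≤ α (i ℕ.+ d)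
    α-mono-+ zero    i _   _     = ℕₚ.≤-reflexive (≡.cong α (≡.sym (ℕₚ.+-identityʳ i)))
    α-mono-+ (suc d) i 1≤i i+d<l = begin
      α i               ≤⟨ α-mono-+ d i 1≤i (ℕₚ.<⇒≤ i+d<l′) ⟩
      α (i ℕ.+ d)       <⟨ α-step (i ℕ.+ d) (ℕₚ.≤-trans 1≤i (ℕₚ.m≤m+n i d)) i+d<l′ ⟩
      α (suc (i ℕ.+ d)) ≡⟨ ≡.cong α (ℕₚ.+-suc i d) ⟨
      α (i ℕ.+ suc d)   ∎
      where i+d<l′ = ≡.subst (_≤ l) (ℕₚ.+-suc i d) i+d<l

    α-tail-+ : ∀ d j → k < j → j ℕ.+ d ≡ l → α j ℕ.+ d ≡ m
    α-tail-+ zero    j _   j+0≡l = begin-equality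
      α j ℕ.+ 0 ≡⟨ ℕₚ.+-identityʳ _ ⟩
      α j       ≡⟨ ≡.cong α (≡.trans (≡.sym (ℕₚ.+-identityʳ j)) j+0≡l) ⟩
      α l       ≡⟨ αl≡m ⟩
      m         ∎
    α-tail-+ (suc d) j k<j j+1+d≡l = begin-equality
      α j ℕ.+ suc d   ≡⟨ ℕₚ.+-suc (α j) d ⟩
      suc (α j) ℕ.+ d ≡⟨ ≡.cong (ℕ._+ d) α-succ ⟨
      α (suc j) ℕ.+ d ≡⟨ α-tail-+ d (suc j) (ℕₚ.m≤n⇒m≤1+n k<j) 1+j+d≡l ⟩
      m               ∎
      where
      j<l = ≡.subst (j <_) j+1+d≡l (ℕₚ.m<m+n j (s≤s z≤n))
      1+j+d≡l = ≡.trans (≡.sym (ℕₚ.+-suc j d)) j+1+d≡l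
      α-succ : α (suc j) ≡ suc (α j)
      α-succ = ℕₚ.≤-antisym (ℕₚ.≤-pred (no-gap-after-k j k<j j<l))
                            (α-step j (ℕₚ.≤-trans 1≤k (ℕₚ.<⇒≤ k<j)) j<l)

  α-mono : ∀ {i j} → 1 ≤ i → i ≤ j → j ≤ l → α i ≤ α j
  α-mono {i} {j} 1≤i i≤j j≤l = ≡.subst (λ j → α i ≤ α j) (ℕₚ.m+[n∸m]≡n i≤j)
    (α-mono-+ (j ∸ i) i 1≤i (≡.subst (_≤ l) (≡.sym (ℕₚ.m+[n∸m]≡n i≤j)) j≤l))

  α≤αk : ∀ i → 1 ≤ i → i ≤ k → α i ≤ α k
  α≤αk i 1≤i i≤k = α-mono 1≤i i≤k (ℕₚ.<⇒≤ k<l)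

  1≤α : ∀ j → 1 ≤ j → j ≤ l → 1 ≤ α j
  1≤α j 1≤j j≤l = ℕₚ.≤-trans (proj₁ α∈I) (α-mono ℕₚ.≤-refl 1≤j j≤l)

  α-tail : ∀ j → k < j → j ≤ l → α j ℕ.+ (l ∸ j) ≡ m
  α-tail j k<j j≤l = α-tail-+ (l ∸ j) j k<j (ℕₚ.m+[n∸m]≡n j≤l)

  αj≤m : ∀ j → k < j → j ≤ l → α j ≤ m
  αj≤m j k<j j≤l = ≡.subst (α j ≤_) (α-tail j k<j j≤l) (ℕₚ.m≤m+n _ _)

  codim+j≡l : ∀ j → k < j → j ≤ l → (m ∸ α j) ℕ.+ j ≡ l
  codim+j≡l j k<j j≤l = begin-equality
    (m ∸ α j) ℕ.+ j               ≡⟨ ≡.cong (λ m → (m ∸ α j) ℕ.+ j) (α-tail j k<j j≤l) ⟨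
    (α j ℕ.+ (l ∸ j) ∸ α j) ℕ.+ j ≡⟨ ≡.cong (ℕ._+ j) (ℕₚ.m+n∸m≡n (α j) (l ∸ j)) ⟩
    (l ∸ j) ℕ.+ j                 ≡⟨ ℕₚ.m∸n+n≡m j≤l ⟩
    l                             ∎

  αk+rest<m : α k ℕ.+ (l ∸ k) < m
  αk+rest<m = begin-strict
    α k ℕ.+ (l ∸ k)           ≡⟨ ≡.cong (α k ℕ.+_) (ℕₚ.+-∸-assoc 1 k<l) ⟩
    α k ℕ.+ suc (l ∸ suc k)   ≡⟨ ℕₚ.+-suc (α k) _ ⟩
    suc (α k) ℕ.+ (l ∸ suc k) <⟨ ℕₚ.+-monoˡ-≤ (l ∸ suc k) gap-at-k ⟩
    α (suc k) ℕ.+ (l ∸ suc k) ≡⟨ α-tail (suc k) ℕₚ.≤-refl k<l ⟩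
    m                         ∎

module SchubertCount (R : CommutativeRing 0ℓ 0ℓ) {q} (R-field : IsFiniteField R q)
  {l m'} (l≤m' : l ≤ m') {α} (α∈I : InI l (suc m') α) (αl≡m : α l ≡ suc m')
  {k} (k-isK : IsK l α k) (c : (Fin l → Fin (suc m')) → CommutativeRing.Carrier R)
  {M} (M-max : Schubert.IsMaxS R l (suc m') α k c M)
  {N} (N-card : HasCard (LinAlg.SameSpan R)
                  (λ b → Schubert.OmegaAlpha R l (suc m') α b × Schubert.OnPi R l (suc m') α c b) N)
  where

  m : ℕ
  m = suc m'

  open CommutativeRing R
  open LinAlg R
  open Schubert R l m α
  open IsFiniteField R-field
  open RingLinearAlgebra R
  open Enumeration setoid card
  open FieldLinearAlgebra R 0≉1 inv _≟_
  open IndexFacts α∈I αl≡m k-isK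
  open Counting
  module ≈-Reasoning = Relation.Binary.Reasoning.Setoid setoid

  xs : List.List (Basis l m)
  xs = proj₁ N-card
  length-xs≡N : List.length xs ≡ N
  length-xs≡N = proj₁ (proj₂ N-card)
  xs⊆Ω : All.All (λ b → OmegaAlpha b × OnPi c b) xs
  xs⊆Ω = proj₁ (proj₂ (proj₂ N-card))
  xs-distinct : AllPairs (λ x y → ¬ SameSpan x y) xs
  xs-distinct = proj₁ (proj₂ (proj₂ (proj₂ N-card)))
  xs-complete : ∀ x → OmegaAlpha x × OnPi c x → Any.Any (SameSpan x) xs
  xs-complete = proj₂ (proj₂ (proj₂ (proj₂ N-card)))

  n a J : ℕ
  n = α k
  a = m ∸ n
  J = a ∸ (l ∸ k)

  1≤k : 1 ≤ k
  1≤k = proj₁ k-isK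
  k≤l : k ≤ l
  k≤l = ℕₚ.<⇒≤ (proj₁ (proj₂ k-isK))
  n<m : n < m
  n<m = ℕₚ.≤-<-trans (ℕₚ.m≤m+n n (l ∸ k)) αk+rest<m
  n≤m : n ≤ m
  n≤m = ℕₚ.<⇒≤ n<m

  rest≤a : l ∸ k ≤ a
  rest≤a = ≡.subst (_≤ a) (ℕₚ.m+n∸m≡n n (l ∸ k)) (ℕₚ.∸-monoˡ-≤ n (ℕₚ.<⇒≤ αk+rest<m))

  shift : Fin a → Fin m
  shift = shiftBy n≤m

  n≤shift : ∀ i → n ≤ toℕ (shift i)
  n≤shift i = ≡.subst (n ≤_) (≡.sym (toℕ-shiftBy n≤m i)) (ℕₚ.m≤m+n n (toℕ i))

  -- The functionals on V_m vanishing on V_n, in coordinates on the last a basis vectors.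
  functional : Vect a → Vect m
  functional f = linComb f (e ∘ shift)

  functional-below : ∀ f x → toℕ x < n → functional f x ≈ 0#
  functional-below f x x<n = sumFin-zero a λ i → trans (*-congˡ (e-offDiagonal (shift i) x
    (λ eq → ℕₚ.<⇒≱ x<n (≡.subst (n ≤_) eq (n≤shift i))))) (zeroʳ _)

  functional-shift : ∀ f i → functional f (shift i) ≈ f i
  functional-shift = linComb-e∘-at shift (shiftBy-injective n≤m)

  dot-functional : ∀ f v → dot (functional f) v ≈ dot f (v ∘ shift)
  dot-functional f v = begin
    dot (functional f) v                       ≈⟨ dot-comm (functional f) v ⟩
    dot v (functional f)                       ≈⟨ dot-linComb v f (e ∘ shift) ⟩
    sumFin a (λ i → f i * dot v (e (shift i))) ≈⟨ sumFin-cong a (λ i → *-congˡ (dot-e v (shift i))) ⟩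
    dot f (v ∘ shift)                          ∎
    where open ≈-Reasoning

  Incident : Fin (q ^ a) → Basis l m → Set
  Incident t y = ∀ r → dot (functional (enumVec a t)) (y r) ≈ 0#

  incident? : ∀ t → Decidable₁ (Incident t)
  incident? t y = Finₚ.all? (λ r → dot (functional (enumVec a t)) (y r) ≟ 0#)

  incidences≥ : ∀ y → OmegaAlpha y → q ^ J ≤ count (λ t → incident? t y)
  incidences≥ y (y-indep , y-dims) = injection≤count (λ t → incident? t y) g g-injective g-incident
    where
    open ≈-Reasoning
    meet = y-dims k 1≤k k≤l
    u = proj₁ meet
    u-indep = proj₁ (proj₂ meet)
    u∈L = λ s → proj₁ (proj₂ (proj₂ meet) s)
    u∈V = λ s → proj₂ (proj₂ (proj₂ meet) s)
    Λ : Fin k → Vect l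
    Λ s = proj₁ (u∈L s)
    u≈Λ·y : ∀ s → u s ≈v linComb (Λ s) y
    u≈Λ·y s = proj₂ (proj₂ (u∈L s))
    Λ-indep : LinIndep Λ
    Λ-indep d d·Λ≈0 = u-indep d λ x → begin
      linComb d u x                       ≈⟨ sumFin-cong k (λ s → *-congˡ (u≈Λ·y s x)) ⟩
      linComb d (λ s → linComb (Λ s) y) x ≈⟨ linComb-linComb d Λ y x ⟩
      linComb (linComb d Λ) y x           ≈⟨ sumFin-zero l (λ r → trans (*-congʳ (d·Λ≈0 r)) (zeroˡ _)) ⟩
      0#                                  ∎
    A : Fin l → Vect a
    A r = y r ∘ shift
    Λ·A≈0 : ∀ s i → linComb (Λ s) A i ≈ 0#
    Λ·A≈0 s i = trans (sym (u≈Λ·y s (shift i))) (InV⇒vanishesFrom (u∈V s) (shift i) (n≤shift i))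
    kernel = kernelDim≥-relatedRows J A Λ Λ-indep Λ·A≈0 (ℕₚ.≤-reflexive (ℕₚ.m∸n+n≡m rest≤a))
    S = proj₁ kernel
    combination : Fin (q ^ J) → Vect a
    combination τ = linComb (enumVec J τ) S
    g : Fin (q ^ J) → Fin (q ^ a)
    g τ = proj₁ (enumVec-surjective a (combination τ))
    combination≈ : ∀ τ → combination τ ≈v enumVec a (g τ)
    combination≈ τ = proj₂ (enumVec-surjective a (combination τ))
    g-injective : ∀ {τ τ'} → g τ ≡ g τ' → τ ≡ τ'
    g-injective {τ} {τ'} gτ≡gτ' = enumVec-injective J (linComb-injective (proj₁ (proj₂ kernel)) λ i →
      trans (combination≈ τ i) (trans (reflexive (≡.cong (λ t → enumVec a t i) gτ≡gτ'))
                                      (sym (combination≈ τ' i))))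
    g-incident : ∀ τ → Incident (g τ) y
    g-incident τ r = begin
      dot (functional (enumVec a (g τ))) (y r)         ≈⟨ dot-functional _ (y r) ⟩
      dot (enumVec a (g τ)) (A r)                      ≈⟨ dot-congˡ (combination≈ τ) (A r) ⟨
      dot (combination τ) (A r)                        ≈⟨ dot-comm (combination τ) (A r) ⟩
      dot (A r) (combination τ)                        ≈⟨ dot-linComb (A r) (enumVec J τ) S ⟩
      sumFin J (λ s → enumVec J τ s * dot (A r) (S s))
        ≈⟨ sumFin-zero J (λ s → trans (*-congˡ (proj₂ (proj₂ kernel) s r)) (zeroʳ _)) ⟩
      0#                                               ∎

  module _ {t : Fin (q ^ a)} {i₀ : Fin a} (ti₀≉0 : ¬ enumVec a t i₀ ≈ 0#) where

    φ : Vect m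
    φ = functional (enumVec a t)

    φ-pivot≉0 : ¬ φ (shift i₀) ≈ 0#
    φ-pivot≉0 φi₀≈0 = ti₀≉0 (trans (sym (functional-shift (enumVec a t) i₀)) φi₀≈0)

    open Hyperplane φ (shift i₀) φ-pivot≉0 (n≤shift i₀) (functional-below (enumVec a t))

    basis-admissible : Admissible k basis
    basis-admissible = basis-linIndep
      , (λ i 1≤i i≤k v → prefix⇒InV (α≤αk i 1≤i i≤k) , InV⇒prefix (α≤αk i 1≤i i≤k))
      , λ v v∈V → prefix-weaken (ℕₚ.≤-pred n<m) (InV⇒prefix ℕₚ.≤-refl v∈V)

    Ω∩ker⇒Ω′ : ∀ {y} → OmegaAlpha y → (∀ r → dot φ (y r) ≈ 0#) → OmegaPrime k basis y
    Ω∩ker⇒Ω′ {y} (y-indep , y-dims) y⊆ker =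
      y-indep , y⊆W , λ j 1≤j j≤l → [ low j 1≤j j≤l , high j 1≤j j≤l ]′ (ℕₚ.≤-<-connex j k)
      where
      y⊆W = λ r → kernel⇒span (y⊆ker r)
      Meet = λ j d → DimMeetGe y (InSpanPrefix basis d) j
      low : ∀ j → 1 ≤ j → j ≤ l → j ≤ k → Meet j (alpha' k α j)
      low j 1≤j j≤l j≤k = ≡.subst (Meet j) (≡.sym (alpha'-≤ k α j j≤k))
        (dimMeetGe-map (λ v → InV⇒prefix {v = v} (α≤αk j 1≤j j≤k)) (y-dims j 1≤j j≤l))
      high : ∀ j → 1 ≤ j → j ≤ l → k < j → Meet j (alpha' k α j)
      high j 1≤j j≤l k<j = ≡.subst (Meet j) (≡.sym (alpha'-> k α j k<j))
        (dimMeet≥ (α j ∸ 1) j basis y y-indep y⊆W (ℕₚ.∸-monoˡ-≤ 1 (αj≤m j k<j j≤l))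
                  (ℕₚ.≤-reflexive codimW+j≡l))
        where
        codimW+j≡l : (m' ∸ (α j ∸ 1)) ℕ.+ j ≡ l
        codimW+j≡l =
          ≡.trans (≡.cong (ℕ._+ j) (pred-∸-pred m' (1≤α j 1≤j j≤l))) (codim+j≡l j k<j j≤l)

    Ω′⇒Ω : ∀ {y} → OmegaPrime k basis y → OmegaAlpha y
    Ω′⇒Ω {y} (y-indep , _ , y-dims′) =
      y-indep , λ j 1≤j j≤l → [ low j 1≤j j≤l , high j j≤l ]′ (ℕₚ.≤-<-connex j k)
      where
      low : ∀ j → 1 ≤ j → j ≤ l → j ≤ k → DimMeetGe y (InV (α j)) j
      low j 1≤j j≤l j≤k = dimMeetGe-map (λ v → prefix⇒InV {v = v} (α≤αk j 1≤j j≤k))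
        (≡.subst (λ d → DimMeetGe y (InSpanPrefix basis d) j) (alpha'-≤ k α j j≤k)
                 (y-dims′ j 1≤j j≤l))
      high : ∀ j → j ≤ l → k < j → DimMeetGe y (InV (α j)) j
      high j j≤l k<j = dimMeet≥ (α j) j e y y-indep (e-spans ∘ y) (αj≤m j k<j j≤l)
        (ℕₚ.≤-reflexive (codim+j≡l j k<j j≤l))

    Ω′⇒⊆ker : ∀ {y} → OmegaPrime k basis y → ∀ r → dot φ (y r) ≈ 0#
    Ω′⇒⊆ker (_ , y⊆W , _) r = span⇒kernel (y⊆W r)

    ⊆ker-SameSpan : ∀ {x y : Basis l m} → (∀ r → dot φ (x r) ≈ 0#) → SameSpan x y →
      ∀ r → dot φ (y r) ≈ 0#
    ⊆ker-SameSpan {x} x⊆ker (_ , y⊆x) r =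
      dot-annihilates-span φ x x⊆ker (proj₁ (y⊆x r)) (proj₂ (proj₂ (y⊆x r)))

    incidences≤M : List.length (List.filter (incident? t) xs) ≤ M
    incidences≤M =
      proj₁ M-max basis basis-admissible (List.length ys) (ys , ≡.refl , ys⊆Ω′ , ys-distinct , ys-complete)
      where
      ys = List.filter (incident? t) xs
      ys⊆Ω′ : All.All (λ b → OmegaPrime k basis b × OnPi c b) ys
      ys⊆Ω′ = All.map (λ ((y-Ω , y-on) , y⊆ker) → Ω∩ker⇒Ω′ y-Ω y⊆ker , y-on)
        (All.zip (Allₚ.filter⁺ (incident? t) xs⊆Ω , Allₚ.all-filter (incident? t) xs))
      ys-distinct = AllPairsₚ.filter⁺ (incident? t) xs-distinct
      ys-complete : ∀ x → OmegaPrime k basis x × OnPi c x → Any.Any (SameSpan x) ys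
      ys-complete x (x-Ω′ , x-on) =
        [ (λ x∈ys → x∈ys) , (λ ¬incident → ⊥-elim (¬incident x-incident)) ]′ (Anyₚ.filter⁺ (incident? t) x∈xs)
        where
        x∈xs = xs-complete x (Ω′⇒Ω x-Ω′ , x-on)
        x-incident : Incident t (Any.lookup x∈xs)
        x-incident = ⊆ker-SameSpan (Ω′⇒⊆ker x-Ω′) (Anyₚ.lookup-result x∈xs)

  t₀ : Fin (q ^ a)
  t₀ = proj₁ (enumVec-surjective a (λ _ → 0#))

  incidences≤M-≢t₀ : ∀ t → t ≢ t₀ → List.length (List.filter (incident? t) xs) ≤ M
  incidences≤M-≢t₀ t t≢t₀ =
    [ (λ (i₀ , ti₀≉0) → incidences≤M {t} {i₀} ti₀≉0) , (λ t≈0 → ⊥-elim (t≢t₀ (t≡t₀ t≈0))) ]′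
      (nonzeroEntry⊎zero (enumVec a t))
    where
    t≡t₀ : (∀ i → enumVec a t i ≈ 0#) → t ≡ t₀
    t≡t₀ t≈0 = enumVec-injective a (λ i → trans (t≈0 i) (proj₂ (enumVec-surjective a (λ _ → 0#)) i))

  N*q^J≤N+[q^a-1]*M : N ℕ.* q ^ J ≤ N ℕ.+ (q ^ a ∸ 1) ℕ.* M
  N*q^J≤N+[q^a-1]*M = begin
    N ℕ.* q ^ J
      ≡⟨ ≡.cong (ℕ._* q ^ J) length-xs≡N ⟨
    List.length xs ℕ.* q ^ J
      ≤⟨ length*≤sumList xs (All.map (λ (y-Ω , _) → incidences≥ _ y-Ω) xs⊆Ω) ⟩
    sumList (λ y → count (λ t → incident? t y)) xs
      ≡⟨ double-counting incident? xs ⟨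
    sum (λ t → List.length (List.filter (incident? t) xs))
      ≤⟨ sum≤-except _ t₀ incidences≤M-≢t₀ ⟩
    List.length (List.filter (incident? t₀) xs) ℕ.+ (q ^ a ∸ 1) ℕ.* M
      ≤⟨ ℕₚ.+-monoˡ-≤ _ (≡.subst (List.length (List.filter (incident? t₀) xs) ≤_) length-xs≡N
                                  (Listₚ.length-filter (incident? t₀) xs)) ⟩
    N ℕ.+ (q ^ a ∸ 1) ℕ.* M
      ∎
    where open ℕₚ.≤-Reasoning

open import Data.Nat using (_*_)

lemma4p4 : (q : ℕ) → IsPrimePower q →
    (R : CommutativeRing 0ℓ 0ℓ) → IsFiniteField R q →
    (l m : ℕ) → 1 ≤ l → l ≤ m ∸ 1 →
    (α : ℕ → ℕ) → InI l m α → α l ≡ m → NotConsecutive l α →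
    (k : ℕ) → IsK l α k →
    (c : (Fin l → Fin m) → CommutativeRing.Carrier R) → Schubert.IsHyperplane R l m α c →
    (M : ℕ) → Schubert.IsMaxS R l m α k c M →
    (N : ℕ) → HasCard (LinAlg.SameSpan R)
                 (λ b → Schubert.OmegaAlpha R l m α b × Schubert.OnPi R l m α c b) N →
    N * (q ^ ((m ∸ α k) ∸ (l ∸ k)) ∸ 1) ≤ (q ^ (m ∸ α k) ∸ 1) * M
lemma4p4 _ _ _ _ _ zero (s≤s z≤n) () _ _ _ _ _ _ _ _ _ _ _ _
lemma4p4 q _ R R-field l (suc m') _ l≤m' α α∈I αl≡m _ k k-isK c _ M M-max N N-card =
  m*n≤m+o⇒m*[n∸1]≤o N _ _
    (SchubertCount.N*q^J≤N+[q^a-1]*M R R-field l≤m' α∈I αl≡m k-isK c M-max N-card)
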